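{- Let $(C_N,w,v_1)$ with $N\geq 3$ be an instance of Adjacent Nim with $w:V\rightarrow \mathbb{N}_{>1}$. \begin{itemize} \item If $N$ is odd, then $(C_N,w,v_1)$ is an $\mathcal{N}$ position. \item If $N$ is even, then $(C_N,w,v_1)$ is an $\mathcal{N}$ position iff $\min\{\underset{1\leq i \leq N}{\operatorname{argmin}}\;w(v_i)\}$ is even. \end{itemize}
   Context: Directed Vertexnim: let $G=(V,E)$ be a strongly connected digraph, $w:V\rightarrow \mathbb{N}_{>0}$ a weight function on the vertices, and $u\in V$ the starting current vertex. Two players alternately decrease the value (weight) of the current vertex $u$ by a positive amount and then choose an out-neighbour of $u$ as the new current vertex. When the weight of a vertex $v$ is set to $0$, $v$ is removed and every pair of arcs $(p,v),(v,s)$ (with $p,s$ not necessarily distinct) is replaced by an arc $(p,s)$. The game ends when $G$ is empty; the player making the last move wins. Adjacent Nim is Directed Vertexnim played on an elementary circuit $C_N=(v_1,\dots,v_N)$ with arcs $(v_i,v_{i+1})$ for $1\le i<N$ and $(v_N,v_1)$; the starting current vertex is $v_1$. A $\mathcal{P}$ position is one from which the second player has a winning strategy, an $\mathcal{N}$ position one from which the first player (the player to move) can win. -}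

module Defs where

open import Data.Nat using (ℕ; zero; suc; _<_; _≤_)
open import Data.List using (List; []; _∷_; _++_)
open import Data.Fin using (Fin; toℕ)
open import Data.Vec.Functional using (Vector; toList)

-- A position of Adjacent Nim on an elementary circuit is encoded as the list of
-- weights of the remaining vertices, starting at the current vertex and then
-- following the arcs of the circuit.  Removing a vertex from a circuit yields a
-- circuit again (for a single vertex: a loop), so this encoding is closed under moves.

data Move : List ℕ → List ℕ → Set where
  -- the new weight w' is still positive: the vertex stays, now at the end of the cycle
  reduce : ∀ {w w' rest} → 0 < w' → w' < w → Move (w ∷ rest) (rest ++ (w' ∷ []))
  remove : ∀ {w rest} → 0 < w → Move (w ∷ rest) rest

data IsN : List ℕ → Set
data IsP : List ℕ → Set

data IsN where
  win : ∀ {l l'} → Move l l' → IsP l' → IsN l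

data IsP where
  lose : ∀ {l} → (∀ {l'} → Move l l' → IsN l') → IsP l

-- The Adjacent Nim instance (C_N, w, v_1): vertices v_1..v_N are Fin N
-- (v_{i+1} is index i), starting at v_1 = index 0.
adjacentNim : ∀ {N} → Vector ℕ N → List ℕ
adjacentNim w = toList w

IsFirstArgmin : ∀ {N} → Vector ℕ N → Fin N → Set
IsFirstArgmin {N} w i =
  (∀ j → w i ≤ w j) × (∀ j → toℕ j < toℕ i → w i < w j)
  where open import Data.Product using (_×_)

module Submission where

-- Every
-- move lowers the total weight, so a family S of positions consists of P
-- positions as soon as every move out of S can be answered by a move back
-- into S or to a known P position (`P-by-strategy`).
--
-- The theorem rests on two such families.
--  * Chains (pairs (1,1) or (a ≥ 1, b ≥ 2), followed by an odd run of 1s):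
--    after the opponent plays on the first vertex of a pair, we play on the
--    second.  Hence every heavy position of odd length is N: lowering the
--    first weight to 1 leaves a chain (`odd-heavy-N`).
--  * Heavy positions of even length whose first minimum sits at an even
--    (0-based) index: a move to 1 or a deletion leaves an N position of the
--    previous kind, and a move to x ≥ 2 is answered by lowering the next
--    weight by one, which keeps the first minimum at an even index
--    (`losing-P`).  If the first minimum is at an odd index, lowering the
--    head by one produces such a position (`odd-index-N`).

open import Defs
open import Data.Nat using (ℕ; _≤_; _<_; suc)
open import Data.Nat.Divisibility using (_∣_)
open import Data.Fin using (Fin; toℕ)
open import Data.Product using (_×_; ∃)
open import Data.Vec.Functional using (Vector)
open import Function.Bundles using (_⇔_)
open import Relation.Nullary using (¬_)

open import Data.Nat using (zero; _+_; _*_; z≤n; s≤s; _≤?_)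
open import Data.Nat.Properties
open import Data.Nat.Divisibility using (divides)
open import Data.Nat.Induction using (<-wellFounded)
open import Data.Nat.ListAction using (sum)
open import Data.Nat.ListAction.Properties using (sum-++)
open import Data.Fin using (zero; suc)
open import Data.Product using (_,_; ∃₂)
open import Data.Sum using (_⊎_; inj₁; inj₂)
open import Data.List using (List; []; _∷_; _∷ʳ_; length)
open import Data.List.Properties using (length-tabulate)
open import Data.List.Membership.Propositional using (_∈_)
open import Data.List.Relation.Unary.Any using (here; there)
open import Data.List.Relation.Unary.All as All using (All; []; _∷_)
open import Data.List.Relation.Unary.All.Properties using (∷ʳ⁺; tabulate⁺)
open import Data.Empty using (⊥; ⊥-elim)
open import Function.Base using (_on_)
open import Function.Bundles using (mk⇔)
open import Induction.WellFounded using (Acc; acc)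
open import Relation.Binary.Construct.On as On using ()
open import Relation.Binary.PropositionalEquality using (_≡_; refl; sym; cong; subst)
open import Relation.Nullary using (yes; no)

private
  variable
    a b m k x : ℕ
    l l' : List ℕ

-- Parity, as mutually inductive predicates so that lists can be peeled
-- two vertices at a time.

data Even : ℕ → Set
data Odd : ℕ → Set

data Even where
  even0 : Even zero
  evenS : Odd k → Even (suc k)

data Odd where
  oddS : Even k → Odd (suc k)

parity : ∀ k → Even k ⊎ Odd k
parity zero = inj₁ even0
parity (suc k) with parity k
... | inj₁ e = inj₂ (oddS e)
... | inj₂ o = inj₁ (evenS o)

Even⇒2∣ : Even k → 2 ∣ k
Even⇒2∣ even0 = divides 0 refl
Even⇒2∣ (evenS (oddS e)) with Even⇒2∣ e
... | divides q eq = divides (suc q) (cong (λ n → suc (suc n)) eq)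

2∣⇒Even : 2 ∣ k → Even k
2∣⇒Even (divides q refl) = even-double q
  where
  even-double : ∀ q → Even (q * 2)
  even-double zero = even0
  even-double (suc q) = evenS (oddS (even-double q))

¬2∣⇒Odd : ¬ 2 ∣ k → Odd k
¬2∣⇒Odd {k} ¬2∣k with parity k
... | inj₁ e = ⊥-elim (¬2∣k (Even⇒2∣ e))
... | inj₂ o = o

length-∷ʳ : ∀ (l : List ℕ) x → length (l ∷ʳ x) ≡ suc (length l)
length-∷ʳ [] x = refl
length-∷ʳ (a ∷ l) x = cong suc (length-∷ʳ l x)

even-∷ʳ : ∀ l x → Odd (length l) → Even (length (l ∷ʳ x))
even-∷ʳ l x o = subst Even (sym (length-∷ʳ l x)) (evenS o)

even-∷ʳ∷ʳ : ∀ l a b → Even (length l) → Even (length (l ∷ʳ a ∷ʳ b))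
even-∷ʳ∷ʳ l a b e = even-∷ʳ (l ∷ʳ a) b (subst Odd (sym (length-∷ʳ l a)) (oddS e))

¬N∧P : IsN l → IsP l → ⊥
¬N∧P (win move p) (lose replies) = ¬N∧P (replies move) p

P-empty : IsP []
P-empty = lose λ ()

move-decreases : Move l l' → sum l' < sum l
move-decreases (remove {w} {rest} w>0) = m<n+m (sum rest) w>0
move-decreases (reduce {w} {w'} {rest} _ w'<w) = begin-strict
  sum (rest ∷ʳ w')      ≡⟨ sum-++ rest (w' ∷ []) ⟩
  sum rest + (w' + 0)   ≡⟨ cong (sum rest +_) (+-identityʳ w') ⟩
  sum rest + w'         ≡⟨ +-comm (sum rest) w' ⟩
  w' + sum rest         <⟨ +-monoˡ-< (sum rest) w'<w ⟩
  w + sum rest          ∎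
  where open ≤-Reasoning

weight-one-removed : Move (1 ∷ l) l' → l' ≡ l
weight-one-removed (reduce {w' = zero} () _)
weight-one-removed (reduce {w' = suc _} _ (s≤s ()))
weight-one-removed (remove _) = refl

Answer : (List ℕ → Set) → List ℕ → Set
Answer S l = ∃ λ l' → Move l l' × (S l' ⊎ IsP l')

N⇒Answer : ∀ {S} → IsN l → Answer S l
N⇒Answer (win move p) = _ , move , inj₂ p

Answer⇒N : ∀ {S : List ℕ → Set} → (∀ {l} → S l → IsP l) → Answer S l → IsN l
Answer⇒N S⊆P (_ , move , inj₁ s) = win move (S⊆P s)
Answer⇒N S⊆P (_ , move , inj₂ p) = win move p

-- Strategy principle: if every move out of S can be answered, S consists of
-- P positions (well-founded induction on the total weight).
P-by-strategy : (S : List ℕ → Set) → (∀ {l l'} → S l → Move l l' → Answer S l') →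
                ∀ {l} → S l → IsP l
P-by-strategy S strategy s = go (On.wellFounded sum <-wellFounded _) s
  where
  go : ∀ {l} → Acc (_<_ on sum) l → S l → IsP l
  go {l} (acc smaller) s = lose reply
    where
    reply : ∀ {l'} → Move l l' → IsN l'
    reply move with strategy s move
    ... | _ , answer , inj₁ s' =
      win answer (go (smaller (<-trans (move-decreases answer) (move-decreases move))) s')
    ... | _ , answer , inj₂ p = win answer p

-- Runs of weight-1 vertices: only deletions are possible, so such a run is
-- P iff its length is even.

data EvenOnes : List ℕ → Set
data OddOnes : List ℕ → Set

data EvenOnes where
  [] : EvenOnes []
  1∷_ : OddOnes l → EvenOnes (1 ∷ l)

data OddOnes where
  1∷_ : EvenOnes l → OddOnes (1 ∷ l)

evenOnes-∷ʳ : EvenOnes l → OddOnes (l ∷ʳ 1)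
oddOnes-∷ʳ : OddOnes l → EvenOnes (l ∷ʳ 1)
evenOnes-∷ʳ [] = 1∷ []
evenOnes-∷ʳ (1∷ o) = 1∷ oddOnes-∷ʳ o
oddOnes-∷ʳ (1∷ e) = 1∷ evenOnes-∷ʳ e

evenOnes-P : EvenOnes l → IsP l
oddOnes-N : OddOnes l → IsN l
evenOnes-P [] = P-empty
evenOnes-P (1∷ o) = lose λ move → subst IsN (sym (weight-one-removed move)) (oddOnes-N o)
oddOnes-N (1∷ e) = win (remove (s≤s z≤n)) (evenOnes-P e)

-- A chain is a sequence of pairs, each (1,1) or (a ≥ 1, b ≥ 2), with at least
-- one pair of the second kind, followed by an odd run of 1s.  `Tail` allows
-- the degenerate case of no pair of the second kind.
data Chain : List ℕ → Set

Tail : List ℕ → Set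
Tail l = Chain l ⊎ OddOnes l

data Chain where
  heavy-pair : 0 < a → 2 ≤ b → Tail l → Chain (a ∷ b ∷ l)
  ones-pair  : Chain l → Chain (1 ∷ 1 ∷ l)

oddOnes-∷ʳ-heavy : OddOnes l → 2 ≤ x → Chain (l ∷ʳ x ∷ʳ 1)
oddOnes-∷ʳ-heavy (1∷ []) 2≤x = heavy-pair (s≤s z≤n) 2≤x (inj₂ (1∷ []))
oddOnes-∷ʳ-heavy (1∷ 1∷ o) 2≤x = ones-pair (oddOnes-∷ʳ-heavy o 2≤x)

chain-∷ʳ : Chain l → 0 < x → Chain (l ∷ʳ x ∷ʳ 1)
tail-∷ʳ : Tail l → 0 < x → Tail (l ∷ʳ x ∷ʳ 1)
chain-∷ʳ (heavy-pair a>0 2≤b t) x>0 = heavy-pair a>0 2≤b (tail-∷ʳ t x>0)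
chain-∷ʳ (ones-pair c) x>0 = ones-pair (chain-∷ʳ c x>0)
tail-∷ʳ (inj₁ c) x>0 = inj₁ (chain-∷ʳ c x>0)
tail-∷ʳ {x = suc zero} (inj₂ o) _ = inj₂ (evenOnes-∷ʳ (oddOnes-∷ʳ o))
tail-∷ʳ {x = suc (suc _)} (inj₂ o) _ = inj₁ (oddOnes-∷ʳ-heavy o (s≤s (s≤s z≤n)))

lower-to-one : 2 ≤ b → Move (b ∷ l) (l ∷ʳ 1)
lower-to-one 2≤b = reduce (s≤s z≤n) 2≤b

-- Answer once the first vertex of a heavy pair has been deleted.
answer-after-remove : 2 ≤ b → Tail l → Answer Chain (b ∷ l)
answer-after-remove 2≤b (inj₁ c) = _ , remove (<⇒≤ 2≤b) , inj₁ c
answer-after-remove 2≤b (inj₂ o) = _ , lower-to-one 2≤b , inj₂ (evenOnes-P (oddOnes-∷ʳ o))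

-- Answer once the first vertex of a heavy pair has been lowered to x.
answer-after-reduce : 2 ≤ b → Tail l → 0 < x → Answer Chain (b ∷ l ∷ʳ x)
answer-after-reduce 2≤b (inj₁ c) x>0 = _ , lower-to-one 2≤b , inj₁ (chain-∷ʳ c x>0)
answer-after-reduce {x = suc zero} 2≤b (inj₂ o) _ =
  _ , remove (<⇒≤ 2≤b) , inj₂ (evenOnes-P (oddOnes-∷ʳ o))
answer-after-reduce {x = suc (suc _)} 2≤b (inj₂ o) _ =
  _ , lower-to-one 2≤b , inj₁ (oddOnes-∷ʳ-heavy o (s≤s (s≤s z≤n)))

-- Chains are P: the opponent plays on the first vertex of a pair, we answer
-- on the second one.
chain-P : Chain l → IsP l
chain-P = P-by-strategy Chain strategy
  where
  strategy : Chain l → Move l l' → Answer Chain l'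
  strategy (ones-pair c) move =
    subst (Answer Chain) (sym (weight-one-removed move)) (_ , remove (s≤s z≤n) , inj₁ c)
  strategy (heavy-pair _ 2≤b t) (remove _) = answer-after-remove 2≤b t
  strategy (heavy-pair _ 2≤b t) (reduce x>0 _) = answer-after-reduce 2≤b t x>0

-- A heavy vertex in front of a tail is N: delete it or lower it to 1.
heavy-head-N : 2 ≤ b → Tail l → IsN (b ∷ l)
heavy-head-N 2≤b t = Answer⇒N chain-P (answer-after-remove 2≤b t)

Heavy : List ℕ → Set
Heavy = All (2 ≤_)

heavy-pairs-tail : Heavy l → Even (length l) → Tail (l ∷ʳ 1)
heavy-pairs-tail {[]} [] even0 = inj₂ (1∷ [])
heavy-pairs-tail {a ∷ b ∷ l} (2≤a ∷ 2≤b ∷ h) (evenS (oddS e)) =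
  inj₁ (heavy-pair (<⇒≤ 2≤a) 2≤b (heavy-pairs-tail h e))

-- A heavy position of odd length is N: lower the current weight to 1.
odd-heavy-N : Heavy l → Odd (length l) → IsN l
odd-heavy-N {a ∷ []} (2≤a ∷ []) _ = win (remove (<⇒≤ 2≤a)) P-empty
odd-heavy-N {a ∷ b ∷ c ∷ l} (2≤a ∷ 2≤b ∷ 2≤c ∷ h) (oddS (evenS (oddS e))) =
  win (lower-to-one 2≤a) (chain-P (heavy-pair (<⇒≤ 2≤b) 2≤c (heavy-pairs-tail h e)))

data FirstMin (m : ℕ) : ℕ → List ℕ → Set where
  here  : All (m ≤_) l → FirstMin m zero (m ∷ l)
  there : m < a → FirstMin m k l → FirstMin m (suc k) (a ∷ l)

firstMin-≤ : FirstMin m k l → All (m ≤_) l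
firstMin-≤ (here m≤l) = ≤-refl ∷ m≤l
firstMin-≤ (there m<a f) = <⇒≤ m<a ∷ firstMin-≤ f

firstMin-∈ : FirstMin m k l → m ∈ l
firstMin-∈ (here _) = here refl
firstMin-∈ (there _ f) = there (firstMin-∈ f)

firstMin-∷ʳ : FirstMin m k l → m ≤ x → FirstMin m k (l ∷ʳ x)
firstMin-∷ʳ (here m≤l) m≤x = here (∷ʳ⁺ m≤l m≤x)
firstMin-∷ʳ (there m<a f) m≤x = there m<a (firstMin-∷ʳ f m≤x)

firstMin-new : All (x <_) l → FirstMin x (length l) (l ∷ʳ x)
firstMin-new [] = here []
firstMin-new (x<a ∷ x<l) = there x<a (firstMin-new x<l)

-- After the opponent lowers the head a₁ of a₁ ∷ a₂ ∷ rest (first minimum at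
-- an even index) to x, the list rest ∷ʳ x has its first minimum at an even
-- index, and that minimum is below a₂.
min-after-reduce : ∀ {a₁ a₂ rest} → FirstMin m k (a₁ ∷ a₂ ∷ rest) → Even k →
                   Even (length rest) → x < a₁ →
                   ∃₂ λ m' k' → FirstMin m' k' (rest ∷ʳ x) × Even k' × m' < a₂
min-after-reduce (here (a₁≤a₂ ∷ a₁≤rest)) even0 e x<a₁ =
  _ , _ , firstMin-new (All.map (<-≤-trans x<a₁) a₁≤rest) , e , <-≤-trans x<a₁ a₁≤a₂
min-after-reduce {m} {x = x} (there _ (there m<a₂ f)) (evenS (oddS k-even)) e _ with m ≤? x
... | yes m≤x = _ , _ , firstMin-∷ʳ f m≤x , k-even , m<a₂
... | no m≰x =
  _ , _ , firstMin-new (All.map (<-≤-trans x<m) (firstMin-≤ f)) , e , <-trans x<m m<a₂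
  where x<m = ≰⇒> m≰x

data Losing (l : List ℕ) : Set where
  losing : Heavy l → Even (length l) → FirstMin m k l → Even k → Losing l

-- Answer to the opponent lowering the head to x ≥ 2: lower the next weight by one.
answer-heavy-reduce : ∀ {a₁ a₂ rest} → Losing (a₁ ∷ a₂ ∷ rest) → 2 ≤ x → x < a₁ →
                      Answer Losing (a₂ ∷ rest ∷ʳ x)
answer-heavy-reduce {x = x} {a₂ = suc y} {rest} (losing (_ ∷ 2≤a₂ ∷ h) (evenS (oddS e)) f k-even) 2≤x x<a₁
  with min-after-reduce f k-even e x<a₁
... | m' , _ , f' , k'-even , m'<a₂ =
  _ , reduce (<⇒≤ 2≤y) (n<1+n y) ,
  inj₁ (losing (∷ʳ⁺ (∷ʳ⁺ h 2≤x) 2≤y) (even-∷ʳ∷ʳ rest x y e) (firstMin-∷ʳ f' m'≤y) k'-even)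
  where
  m'≤y : m' ≤ y
  m'≤y = ≤-pred m'<a₂
  2≤y : 2 ≤ y
  2≤y = ≤-trans (All.lookup (∷ʳ⁺ h 2≤x) (firstMin-∈ f')) m'≤y

-- Positions in `Losing` are P: deleting the head or lowering it to 1 leaves
-- an N position, lowering it to x ≥ 2 is answered by `answer-heavy-reduce`.
losing-P : Losing l → IsP l
losing-P = P-by-strategy Losing strategy
  where
  strategy : Losing l → Move l l' → Answer Losing l'
  strategy (losing (_ ∷ h) (evenS o) _ _) (remove _) = N⇒Answer (odd-heavy-N h o)
  strategy (losing (_ ∷ 2≤a₂ ∷ h) (evenS (oddS e)) _ _) (reduce {w' = suc zero} _ _) =
    N⇒Answer (heavy-head-N 2≤a₂ (heavy-pairs-tail h e))
  strategy p@(losing (_ ∷ _ ∷ _) _ _ _) (reduce {w' = suc (suc _)} _ x<a₁) =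
    answer-heavy-reduce p (s≤s (s≤s z≤n)) x<a₁

-- With the first minimum at an odd index, lowering the head by one is winning.
odd-index-N : Heavy l → Even (length l) → FirstMin m k l → Odd k → IsN l
odd-index-N {suc y ∷ l} (_ ∷ h) (evenS o) (there m<a f) (oddS k-even) =
  win (reduce (<⇒≤ 2≤y) (n<1+n y))
      (losing-P (losing (∷ʳ⁺ h 2≤y) (even-∷ʳ l y o) (firstMin-∷ʳ f (≤-pred m<a)) k-even))
  where
  2≤y : 2 ≤ y
  2≤y = ≤-trans (All.lookup h (firstMin-∈ f)) (≤-pred m<a)

firstArgmin⇒FirstMin : ∀ {n} (w : Vector ℕ n) i → IsFirstArgmin w i →
                       FirstMin (w i) (toℕ i) (adjacentNim w)
firstArgmin⇒FirstMin w zero (min , _) = here (tabulate⁺ (λ j → min (suc j)))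
firstArgmin⇒FirstMin w (suc i) (min , first) =
  there (first zero (s≤s z≤n))
        (firstArgmin⇒FirstMin (λ j → w (suc j)) i ((λ j → min (suc j)) , λ j j<i → first (suc j) (s≤s j<i)))

firstArgmin-exists : ∀ n (w : Vector ℕ (suc n)) → ∃ λ i → IsFirstArgmin w i
firstArgmin-exists zero w = zero , (λ { zero → ≤-refl }) , (λ _ ())
firstArgmin-exists (suc n) w with firstArgmin-exists n (λ j → w (suc j))
... | i , min , first with w zero ≤? w (suc i)
... | yes w₀≤ = zero , (λ { zero → ≤-refl ; (suc j) → ≤-trans w₀≤ (min j) }) , (λ _ ())
... | no w₀≰ =
  suc i , (λ { zero → <⇒≤ w<w₀ ; (suc j) → min j }) ,
  (λ { zero _ → w<w₀ ; (suc j) (s≤s j<i) → first j j<i })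
  where w<w₀ = ≰⇒> w₀≰

theorem1 : (N : ℕ) → 3 ≤ N → (w : Vector ℕ N) → (∀ i → 1 < w i) →
    ((¬ (2 ∣ N)) → IsN (adjacentNim w)) ×
    ((2 ∣ N) → (IsN (adjacentNim w) ⇔ ∃ λ i → IsFirstArgmin w i × (2 ∣ suc (toℕ i))))
theorem1 (suc n) _ w w>1 = odd-case , even-case
  where
  heavy : Heavy (adjacentNim w)
  heavy = tabulate⁺ w>1

  odd-case : ¬ 2 ∣ suc n → IsN (adjacentNim w)
  odd-case ¬2∣N = odd-heavy-N heavy (subst Odd (sym (length-tabulate w)) (¬2∣⇒Odd ¬2∣N))

  even-case : 2 ∣ suc n → (IsN (adjacentNim w) ⇔ ∃ λ i → IsFirstArgmin w i × (2 ∣ suc (toℕ i)))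
  even-case 2∣N = mk⇔ N⇒even-argmin even-argmin⇒N
    where
    even-length : Even (length (adjacentNim w))
    even-length = subst Even (sym (length-tabulate w)) (2∣⇒Even 2∣N)

    even-argmin⇒N : (∃ λ i → IsFirstArgmin w i × (2 ∣ suc (toℕ i))) → IsN (adjacentNim w)
    even-argmin⇒N (i , argmin , 2∣i+1) with 2∣⇒Even 2∣i+1
    ... | evenS i-odd = odd-index-N heavy even-length (firstArgmin⇒FirstMin w i argmin) i-odd

    N⇒even-argmin : IsN (adjacentNim w) → ∃ λ i → IsFirstArgmin w i × (2 ∣ suc (toℕ i))
    N⇒even-argmin isN with firstArgmin-exists n w
    ... | i , argmin with parity (toℕ i)
    ... | inj₁ i-even = ⊥-elim (¬N∧P isN (losing-P
            (losing heavy even-length (firstArgmin⇒FirstMin w i argmin) i-even)))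
    ... | inj₂ i-odd = i , argmin , Even⇒2∣ (evenS i-odd)
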